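{- Let $\mathcal{A} = (Q, \delta, I, \delta_F)$ be a Büchi automaton over a finite nonempty alphabet $\Sigma$ such that every accepting SCC of $\mathcal{A}$ is an IADAC (initial almost deterministic accepting component). Let $\mathcal{B}$ be the deterministic automaton with state set $2^Q$, initial state $I$, transitions $R \xrightarrow{a} S$ for every $R \subseteq Q$ and $a \in \Sigma$ with $S = \bigcup_{r \in R} \delta(r,a)$, where such a transition is coloured (with the colour $0$) iff $\bigcup_{r \in R} \delta_F(r,a) \neq \emptyset$, and with acceptance condition $\mathrm{Fin}(0)$: a word $w \in \Sigma^\omega$ is accepted by $\mathcal{B}$ iff the unique run of $\mathcal{B}$ on $w$ from $I$ takes coloured transitions only finitely often. Then $L(\mathcal{A}) = \Sigma^\omega \setminus L(\mathcal{B})$.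
   Context: A Büchi automaton (BA) $\mathcal{A} = (Q, \delta, I, \delta_F)$ over $\Sigma$ has a finite state set $Q$, transitions $\delta \subseteq Q \times \Sigma \times Q$ (written $q \xrightarrow{a} r$), initial states $I \subseteq Q$, and accepting transitions $\delta_F \subseteq \delta$. Write $\delta(r,a) = \{p \mid r \xrightarrow{a} p \in \delta\}$ and $\delta_F(r,a) = \{p \mid r \xrightarrow{a} p \in \delta_F\}$. A run on $w = w_0w_1\dots \in \Sigma^\omega$ from $q$ is a sequence $\rho_0\rho_1\dots$ of states with $\rho_0 = q$ and $\rho_i \xrightarrow{w_i} \rho_{i+1} \in \delta$ for all $i$; it is accepting iff it uses transitions of $\delta_F$ infinitely often. $L(\mathcal{A})$ is the set of words having an accepting run from some initial state. A state is useless if no word is accepted from it. For $C \subseteq Q$, $\delta|_C = \{q \xrightarrow{a} r \in \delta \mid q, r \in C\}$. A strongly connected component (SCC) is a maximal nonempty set of states that are mutually reachable; an SCC is accepting if it contains at least one transition of $\delta_F$ (i.e., $\delta_F \cap \delta|_C \neq \emptyset$). Standing convention: every transition whose source and target lie in different SCCs is not in $\delta_F$. For an SCC $C$, let $\mathcal{B}_C$ be the BA obtained from $(Q, \delta, I, \delta_F \cap \delta|_C)$ by removing its useless states (and the transitions incident to them). $C$ is initial almost deterministic if for any two transitions $q \xrightarrow{a} p$ and $q \xrightarrow{a} r$ of $\mathcal{B}_C$ from the same state over the same symbol, either $p = r$ or neither $p$ nor $r$ lies in the same SCC as $q$. An IADAC is an accepting SCC that is initial almost deterministic. -}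

module Defs where

open import Data.Nat using (ℕ; zero; suc; _≤_; _<_)
open import Data.Fin using (Fin)
open import Data.Fin.Subset using (Subset; _∈_; _∉_; _⊆_; ⋃; Nonempty)
open import Data.Fin.Subset.Properties using (_∈?_)
open import Data.List using (List; map; filter; allFin)
open import Data.Product using (Σ; ∃; ∃-syntax; _×_; _,_)
open import Data.Sum using (_⊎_)
open import Relation.Nullary using (¬_)
open import Relation.Binary.PropositionalEquality using (_≡_)
open import Relation.Binary.Construct.Closure.ReflexiveTransitive using (Star)

Word : ℕ → Set
Word k = ℕ → Fin k

-- A Büchi automaton with state set Q = Fin n over Σ = Fin k.
-- δ q a is the set δ(q,a) of a-successors of q; the transition q -a-> r
-- is in δ iff r ∈ δ q a.
record BA (n k : ℕ) : Set where
  field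
    δ     : Fin n → Fin k → Subset n
    I     : Subset n
    δF    : Fin n → Fin k → Subset n
    δF⊆δ  : ∀ q a → δF q a ⊆ δ q a

module _ {n k : ℕ} (A : BA n k) where
  open BA A

  Step : Fin n → Fin n → Set
  Step q r = ∃[ a ] (r ∈ δ q a)

  Reach : Fin n → Fin n → Set
  Reach = Star Step

  SameSCC : Fin n → Fin n → Set
  SameSCC q r = Reach q r × Reach r q

  IsSCC : Subset n → Set
  IsSCC C = (∃[ q ] q ∈ C)
          × (∀ q r → q ∈ C → r ∈ C → Reach q r)
          × (∀ q r → q ∈ C → Reach q r → Reach r q → r ∈ C)

  AcceptingSCC : Subset n → Set
  AcceptingSCC C = IsSCC C × (∃[ q ] ∃[ a ] ∃[ r ] (q ∈ C × r ∈ C × r ∈ δF q a))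

  -- the standing convention: transitions between different SCCs are not accepting
  Convention : Set
  Convention = ∀ q a r → r ∈ δF q a → SameSCC q r

  IsRun : Word k → Fin n → (ℕ → Fin n) → Set
  IsRun w q ρ = (ρ 0 ≡ q) × (∀ i → ρ (suc i) ∈ δ (ρ i) (w i))

  InfOften : (Fin n → Fin k → Fin n → Set) → Word k → (ℕ → Fin n) → Set
  InfOften F w ρ = ∀ i → ∃[ j ] (i ≤ j × F (ρ j) (w j) (ρ (suc j)))

  AccTr : Fin n → Fin k → Fin n → Set
  AccTr q a r = r ∈ δF q a

  InL : Word k → Set
  InL w = ∃[ q ] (q ∈ I × ∃[ ρ ] (IsRun w q ρ × InfOften AccTr w ρ))

  -- accepting transitions of the BA (Q, δ, I, δF ∩ δ|_C)
  AccTrC : Subset n → Fin n → Fin k → Fin n → Set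
  AccTrC C q a r = r ∈ δF q a × q ∈ C × r ∈ C

  UsefulC : Subset n → Fin n → Set
  UsefulC C p = ∃[ w ] ∃[ ρ ] (IsRun w p ρ × InfOften (AccTrC C) w ρ)

  -- C is initial almost deterministic: in B_C (useless states and their
  -- transitions removed), two a-transitions from the same state q either
  -- agree or both leave the SCC of q.
  InitialAlmostDet : Subset n → Set
  InitialAlmostDet C =
    ∀ q a p r → UsefulC C q → UsefulC C p → UsefulC C r →
    p ∈ δ q a → r ∈ δ q a →
    (p ≡ r) ⊎ (¬ SameSCC q p × ¬ SameSCC q r)

  IADAC : Subset n → Set
  IADAC C = AcceptingSCC C × InitialAlmostDet C

  AllAccSCCsIADAC : Set
  AllAccSCCsIADAC = ∀ (C : Subset n) → AcceptingSCC C → IADAC C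

  elems : Subset n → List (Fin n)
  elems R = filter (_∈? R) (allFin n)

  postB : Subset n → Fin k → Subset n
  postB R a = ⋃ (map (λ r → δ r a) (elems R))

  postF : Subset n → Fin k → Subset n
  postF R a = ⋃ (map (λ r → δF r a) (elems R))

  runB : Word k → ℕ → Subset n
  runB w zero    = I
  runB w (suc i) = postB (runB w i) (w i)

  ColouredB : Word k → ℕ → Set
  ColouredB w i = Nonempty (postF (runB w i) (w i))

  InLB : Word k → Set
  InLB w = ∃[ N ] (∀ j → N ≤ j → ¬ ColouredB w j)

-- Every state of a run of A from I lies in the corresponding state of the
-- subset run, so the subset run is coloured whenever that run is accepting.
-- Conversely, if the subset run is coloured infinitely often, then infinitely
-- often one and the same state q of it has an outgoing δF-transition on the
-- current letter.  By König's lemma there is a run ρ of A from I that can, at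
-- every time, still reach q at infinitely many of those times; so all states
-- of ρ are useful for the accepting SCC of q.  Since ρ eventually stays in one
-- SCC, almost determinism then forces every run segment from ρ to q to agree
-- with ρ: ρ visits q at infinitely many such times, and at each of them almost
-- determinism again forces ρ to take the accepting transition out of q.
module Submission where

open import Defs
open import Level using (0ℓ)
open import Axiom.ExcludedMiddle using (ExcludedMiddle)
open import Axiom.DoubleNegationElimination using (em⇒dne)
open import Data.Bool.Properties using (T-≡)
open import Data.Nat using (ℕ; zero; suc; _≤_; _<_; _⊔_; _≤′_; ≤′-refl; ≤′-step)
open import Data.Nat.Properties using (≤-refl; ≤-trans; m≤m⊔n; m≤n⊔m; m≤n⇒m≤1+n; 1+n≰n; ≤⇒≤′)
import Data.Nat.InfinitelyOften as Often
open import Data.Fin using (Fin; zero; suc)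
open import Data.Fin.Subset using (Subset; _∈_; ⋃; Nonempty)
open import Data.Fin.Subset.Properties using (_∈?_; ∉⊥; x∈p∪q⁺; x∈p∪q⁻)
open import Data.List using (List; []; _∷_; map; allFin)
open import Data.List.Relation.Unary.Any using (here; there)
open import Data.List.Membership.Propositional using () renaming (_∈_ to _∈ₗ_)
open import Data.List.Membership.Propositional.Properties
  using (∈-map⁺; ∈-map⁻; ∈-filter⁺; ∈-filter⁻; ∈-allFin)
open import Data.Vec using (tabulate)
open import Data.Vec.Properties using (lookup⇒[]=; []=⇒lookup; lookup∘tabulate)
open import Data.Product using (Σ; ∃; ∃-syntax; _×_; _,_; proj₁; proj₂; map₂)
open import Data.Sum using (_⊎_; inj₁; inj₂; [_,_])
open import Effect.Monad using (RawMonad)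
open import Function using (_∘_; id)
open import Function.Bundles using (_⇔_; mk⇔; Equivalence)
open import Relation.Nullary using (¬_; contradiction)
open import Relation.Nullary.Negation using (¬¬-Monad)
open import Relation.Nullary.Decidable using (⌊_⌋; toWitness; fromWitness)
open import Relation.Unary using (Decidable)
open import Relation.Binary.PropositionalEquality using (_≡_; refl; sym; trans; subst; subst₂; cong)
open import Relation.Binary.Construct.Closure.ReflexiveTransitive using (ε; _◅_; _◅◅_)

Infinitely : (ℕ → Set) → Set
Infinitely P = ∀ N → ∃[ j ] (N ≤ j × P j)

private
  variable
    P Q : ℕ → Set

Infinitely-map : (∀ {j} → P j → Q j) → Infinitely P → Infinitely Q
Infinitely-map f inf = map₂ (map₂ f) ∘ inf

Infinitely-from : ∀ M → Infinitely P → Infinitely (λ j → M ≤ j × P j)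
Infinitely-from M inf N =
  let (j , M⊔N≤j , p) = inf (M ⊔ N)
  in j , ≤-trans (m≤n⊔m M N) M⊔N≤j , ≤-trans (m≤m⊔n M N) M⊔N≤j , p

Infinitely-const : ∀ {X : Set} → Infinitely (λ j → X × P j) → X × Infinitely P
Infinitely-const inf = proj₁ (proj₂ (proj₂ (inf 0))) , Infinitely-map proj₂ inf

Infinitely⇒Inf : Infinitely P → Often.Inf P
Infinitely⇒Inf inf (i , fin) = let (j , i≤j , p) = inf i in fin j i≤j p

Inf⇒Infinitely : ExcludedMiddle 0ℓ → Often.Inf P → Infinitely P
Inf⇒Infinitely em inf N = em⇒dne em λ none → inf (N , λ j N≤j p → none (j , N≤j , p))

Inf-pigeonhole : ∀ {m} (P : ℕ → Fin m → Set) →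
  Often.Inf (λ j → ∃ (P j)) → ¬ ¬ ∃ λ x → Often.Inf (λ j → P j x)
Inf-pigeonhole {zero} P inf = contradiction (0 , λ { _ _ (() , _) }) inf
Inf-pigeonhole {suc m} P inf =
  Often.commutes-with-∪ (Often.map split inf) >>=
    [ (λ inf₀ → pure (zero , inf₀))
    , (λ inf₊ → map-suc <$> Inf-pigeonhole (λ j x → P j (suc x)) inf₊) ]
  where
  open RawMonad (¬¬-Monad {a = 0ℓ})
  split : ∀ {j} → ∃ (P j) → P j zero ⊎ ∃ (P j ∘ suc)
  split (zero , p) = inj₁ p
  split (suc x , p) = inj₂ (x , p)
  map-suc : ∃ (λ x → Often.Inf (λ j → P j (suc x))) → ∃ λ x → Often.Inf (λ j → P j x)
  map-suc (x , inf) = suc x , inf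

Infinitely-pigeonhole : ExcludedMiddle 0ℓ → ∀ {m} (P : ℕ → Fin m → Set) →
  Infinitely (λ j → ∃ (P j)) → ∃ λ x → Infinitely (λ j → P j x)
Infinitely-pigeonhole em P inf =
  map₂ (Inf⇒Infinitely em) (em⇒dne em (Inf-pigeonhole P (Infinitely⇒Inf inf)))

∈-tabulate-isYes : ∀ {n} {P : Fin n → Set} (P? : Decidable P) {x} →
  x ∈ tabulate (λ y → ⌊ P? y ⌋) ⇔ P x
∈-tabulate-isYes P? {x} = mk⇔
  (λ x∈ → toWitness (Equivalence.from T-≡ (trans (sym (lookup∘tabulate _ x)) ([]=⇒lookup x∈))))
  (λ p → lookup⇒[]= x _ (trans (lookup∘tabulate _ x) (Equivalence.to T-≡ (fromWitness p))))

∈-⋃⁺ : ∀ {n} {xs : List (Subset n)} {S x} → S ∈ₗ xs → x ∈ S → x ∈ ⋃ xs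
∈-⋃⁺ (here refl) x∈S = x∈p∪q⁺ (inj₁ x∈S)
∈-⋃⁺ {xs = S ∷ _} (there S∈xs) x∈T = x∈p∪q⁺ {p = S} (inj₂ (∈-⋃⁺ S∈xs x∈T))

∈-⋃⁻ : ∀ {n} (xs : List (Subset n)) {x} → x ∈ ⋃ xs → ∃[ S ] (S ∈ₗ xs × x ∈ S)
∈-⋃⁻ [] x∈⊥ = contradiction x∈⊥ ∉⊥
∈-⋃⁻ (S ∷ xs) x∈ with x∈p∪q⁻ S (⋃ xs) x∈
... | inj₁ x∈S = S , here refl , x∈S
... | inj₂ x∈⋃xs = let (T , T∈xs , x∈T) = ∈-⋃⁻ xs x∈⋃xs in T , there T∈xs , x∈T

infixr 5 _∷ˢ_
_∷ˢ_ : ∀ {X : Set} → X → (ℕ → X) → ℕ → X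
(x ∷ˢ f) zero = x
(x ∷ˢ f) (suc i) = f i

module _ {n k : ℕ} (A : BA n k) where
  open BA A

  ∈-⋃-image⁺ : ∀ (f : Fin n → Subset n) {R p s} → p ∈ R → s ∈ f p → s ∈ ⋃ (map f (elems A R))
  ∈-⋃-image⁺ f {R} {p} p∈R s∈fp = ∈-⋃⁺ (∈-map⁺ f (∈-filter⁺ (_∈? R) (∈-allFin p) p∈R)) s∈fp

  ∈-⋃-image⁻ : ∀ (f : Fin n → Subset n) {R s} → s ∈ ⋃ (map f (elems A R)) → ∃[ p ] (p ∈ R × s ∈ f p)
  ∈-⋃-image⁻ f {R} s∈ with ∈-⋃⁻ (map f (elems A R)) s∈
  ... | S , S∈ , s∈S with ∈-map⁻ f S∈
  ...   | p , p∈elems , refl = p , proj₂ (∈-filter⁻ (_∈? R) {xs = allFin n} p∈elems) , s∈S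

  run⊆runB : ∀ {w q ρ} → IsRun A w q ρ → q ∈ I → ∀ i → ρ i ∈ runB A w i
  run⊆runB (refl , _) q∈I zero = q∈I
  run⊆runB {w} run q∈I (suc i) = ∈-⋃-image⁺ (λ x → δ x (w i)) (run⊆runB run q∈I i) (proj₂ run i)

  InL⇒¬InLB : ∀ w → InL A w → ¬ InLB A w
  InL⇒¬InLB w (q , q∈I , ρ , run , acc) (N , uncoloured) =
    let (j , N≤j , ρ⟶) = acc N
    in uncoloured j N≤j (_ , ∈-⋃-image⁺ (λ x → δF x (w j)) (run⊆runB run q∈I j) ρ⟶)

  -- Path w t s j s′: a run segment reading w t … w (j − 1), from s at time t to s′ at time j
  data Path (w : Word k) : ℕ → Fin n → ℕ → Fin n → Set where
    done : ∀ {t s} → Path w t s t s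
    step : ∀ {t s s′ j s″} → s′ ∈ δ s (w t) → Path w (suc t) s′ j s″ → Path w t s j s″

  Path-snoc : ∀ {w t s j p s′} → Path w t s j p → s′ ∈ δ p (w j) → Path w t s (suc j) s′
  Path-snoc done s′∈ = step s′∈ done
  Path-snoc (step s₁∈ P) s′∈ = step s₁∈ (Path-snoc P s′∈)

  Path⇒Reach : ∀ {w t s j s′} → Path w t s j s′ → Reach A s s′
  Path⇒Reach done = ε
  Path⇒Reach {w} {t} (step s₁∈ P) = (w t , s₁∈) ◅ Path⇒Reach P

  Path-uncons : ∀ {w t s j s″} → t < j → Path w t s j s″ →
    ∃[ s′ ] (s′ ∈ δ s (w t) × Path w (suc t) s′ j s″)
  Path-uncons t<t done = contradiction t<t 1+n≰n
  Path-uncons _ (step s′∈ P) = _ , s′∈ , P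

  runB⇒Path : ∀ w j {s} → s ∈ runB A w j → ∃[ p ] (p ∈ I × Path w 0 p j s)
  runB⇒Path w zero {s} s∈I = s , s∈I , done
  runB⇒Path w (suc j) s∈ =
    let (p′ , p′∈ , s∈δ) = ∈-⋃-image⁻ (λ x → δ x (w j)) s∈
        (p , p∈I , P) = runB⇒Path w j p′∈
    in p , p∈I , Path-snoc P s∈δ

  UsefulC-step : ∀ {C s s′ a} → s′ ∈ δ s a → UsefulC A C s′ → UsefulC A C s
  UsefulC-step {s = s} {a = a} s′∈ (w , ρ , (refl , run) , acc) =
    a ∷ˢ w , s ∷ˢ ρ , (refl , run′) ,
    λ i → let (j , i≤j , accⱼ) = acc i in suc j , m≤n⇒m≤1+n i≤j , accⱼ
    where
    run′ : ∀ i → (s ∷ˢ ρ) (suc i) ∈ δ ((s ∷ˢ ρ) i) ((a ∷ˢ w) i)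
    run′ zero = s′∈
    run′ (suc i) = run i

  UsefulC-Reach : ∀ {C s q} → Reach A s q → UsefulC A C q → UsefulC A C s
  UsefulC-Reach ε = id
  UsefulC-Reach ((_ , s′∈) ◅ s′⇝q) = UsefulC-step s′∈ ∘ UsefulC-Reach s′⇝q

  lasso⇒UsefulC : ∀ {C q a r} → r ∈ δF q a → Reach A r q → q ∈ C → r ∈ C → UsefulC A C q
  lasso⇒UsefulC {C} {q} {a} {r} r∈δF r⇝q q∈C r∈C =
    word , run , (refl , move-step ∘ position) , λ i → accepting-ahead i (proj₂ (position i)) refl
    where
    -- a point of the cycle q ─a→ r ⇝ q, given with the rest of the way back to q
    Position : Set
    Position = Σ (Fin n) (λ s → Reach A s q)

    move : Position → Fin k × Position
    move (_ , ε) = a , (r , r⇝q)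
    move (_ , (b , _) ◅ s′⇝q) = b , (_ , s′⇝q)

    move-step : ∀ p → proj₁ (proj₂ (move p)) ∈ δ (proj₁ p) (proj₁ (move p))
    move-step (_ , ε) = δF⊆δ q a r∈δF
    move-step (_ , (_ , s′∈) ◅ _) = s′∈

    position : ℕ → Position
    position zero = q , ε
    position (suc i) = proj₂ (move (position i))

    word : Word k
    word = proj₁ ∘ move ∘ position

    run : ℕ → Fin n
    run = proj₁ ∘ position

    accepting-ahead : ∀ i {s} (s⇝q : Reach A s q) → position i ≡ (s , s⇝q) →
      ∃[ j ] (i ≤ j × AccTrC A C (run j) (word j) (run (suc j)))
    accepting-ahead i ε eq =
      i , ≤-refl ,
      subst (λ p → AccTrC A C (proj₁ p) (proj₁ (move p)) (proj₁ (proj₂ (move p)))) (sym eq)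
            (r∈δF , q∈C , r∈C)
    accepting-ahead i (_ ◅ s′⇝q) eq =
      let (j , 1+i≤j , accⱼ) = accepting-ahead (suc i) s′⇝q (cong (proj₂ ∘ move) eq)
      in j , ≤-trans (m≤n⇒m≤1+n ≤-refl) 1+i≤j , accⱼ

  SameSCC-sym : ∀ {p q} → SameSCC A p q → SameSCC A q p
  SameSCC-sym (p⇝q , q⇝p) = q⇝p , p⇝q

  SameSCC-trans : ∀ {p q r} → SameSCC A p q → SameSCC A q r → SameSCC A p r
  SameSCC-trans (p⇝q , q⇝p) (q⇝r , r⇝q) = p⇝q ◅◅ q⇝r , r⇝q ◅◅ q⇝p

  module _ (em : ExcludedMiddle 0ℓ) where

    sccOf : Fin n → Subset n
    sccOf q = tabulate (λ s → ⌊ em {SameSCC A q s} ⌋)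

    ∈-sccOf : ∀ {q s} → s ∈ sccOf q ⇔ SameSCC A q s
    ∈-sccOf {q} = ∈-tabulate-isYes (λ s → em {SameSCC A q s})

    sccOf-IsSCC : ∀ q → IsSCC A (sccOf q)
    sccOf-IsSCC q =
      (q , from ∈-sccOf (ε , ε)) ,
      (λ s t s∈ t∈ → proj₁ (SameSCC-trans (SameSCC-sym (to ∈-sccOf s∈)) (to ∈-sccOf t∈))) ,
      (λ s t s∈ s⇝t t⇝s → from ∈-sccOf (SameSCC-trans (to ∈-sccOf s∈) (s⇝t , t⇝s)))
      where open Equivalence

    module _ (conv : Convention A) {q a r} (r∈δF : r ∈ δF q a) where
      open Equivalence

      sccOf-AcceptingSCC : AcceptingSCC A (sccOf q)
      sccOf-AcceptingSCC =
        sccOf-IsSCC q , q , a , r , from ∈-sccOf (ε , ε) , from ∈-sccOf (conv q a r r∈δF) , r∈δF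

      sccOf-UsefulC : UsefulC A (sccOf q) q
      sccOf-UsefulC = lasso⇒UsefulC r∈δF (proj₂ (conv q a r r∈δF))
                                    (from ∈-sccOf (ε , ε)) (from ∈-sccOf (conv q a r r∈δF))

  Steps : Word k → (ℕ → Fin n) → Set
  Steps w ρ = ∀ t → ρ (suc t) ∈ δ (ρ t) (w t)

  Steps⇒Reach : ∀ {w ρ} → Steps w ρ → ∀ {i j} → i ≤′ j → Reach A (ρ i) (ρ j)
  Steps⇒Reach steps ≤′-refl = ε
  Steps⇒Reach {w} steps (≤′-step {j} i≤′j) = Steps⇒Reach steps i≤′j ◅◅ ((w j , steps j) ◅ ε)

  -- ρ revisits some state p infinitely often, and each ρ t after the first visit lies
  -- between two visits of p.
  Steps⇒eventually-SameSCC : ExcludedMiddle 0ℓ → ∀ {w ρ} → Steps w ρ →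
    ∃[ t₀ ] (∀ t → t₀ ≤ t → SameSCC A (ρ t) (ρ (suc t)))
  Steps⇒eventually-SameSCC em {w} {ρ} steps =
    let (p , visits) = Infinitely-pigeonhole em (λ j p → ρ j ≡ p) (λ N → N , ≤-refl , _ , refl)
        (t₀ , _ , ρt₀≡p) = visits 0
        p~ρ : ∀ t → t₀ ≤ t → SameSCC A p (ρ t)
        p~ρ t t₀≤t =
          let (j , t≤j , ρj≡p) = visits t
          in subst (λ x → Reach A x (ρ t)) ρt₀≡p (reach t₀≤t) ,
             subst (Reach A (ρ t)) ρj≡p (reach t≤j)
    in t₀ , λ t t₀≤t → SameSCC-trans (SameSCC-sym (p~ρ t t₀≤t)) (p~ρ (suc t) (m≤n⇒m≤1+n t₀≤t))
    where
    reach : ∀ {i j} → i ≤ j → Reach A (ρ i) (ρ j)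
    reach = Steps⇒Reach steps ∘ ≤⇒≤′

  IAD-successor-unique : ∀ {C s a p r} → InitialAlmostDet A C →
    UsefulC A C s → UsefulC A C p → UsefulC A C r →
    p ∈ δ s a → r ∈ δ s a → SameSCC A s r → p ≡ r
  IAD-successor-unique iad s-useful p-useful r-useful p∈ r∈ s~r
    with iad _ _ _ _ s-useful p-useful r-useful p∈ r∈
  ... | inj₁ p≡r = p≡r
  ... | inj₂ (_ , s≁r) = contradiction s~r s≁r

  ¬InLB⇒recurrent-source : ExcludedMiddle 0ℓ → ∀ w → ¬ InLB A w →
    ∃ λ q → Infinitely (λ j → Nonempty (δF q (w j)) × q ∈ runB A w j)
  ¬InLB⇒recurrent-source em w ¬inLB =
    Infinitely-pigeonhole em _ (Infinitely-map source (Inf⇒Infinitely em ¬inLB))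
    where
    source : ∀ {j} → ColouredB A w j → ∃ λ q → Nonempty (δF q (w j)) × q ∈ runB A w j
    source {j} (r , r∈) =
      let (q , q∈ , r∈δF) = ∈-⋃-image⁻ (λ x → δF x (w j)) r∈ in q , (r , r∈δF) , q∈

  module König (em : ExcludedMiddle 0ℓ) (w : Word k) (q : Fin n) (J : ℕ → Set)
               (recurrent : Infinitely (λ j → J j × q ∈ runB A w j)) where

    Good : ℕ → Fin n → Set
    Good t s = Infinitely (λ j → J j × Path w t s j q)

    good-initial : ∃[ p ] (p ∈ I × Good 0 p)
    good-initial =
      map₂ Infinitely-const (Infinitely-pigeonhole em _ (Infinitely-map from-I recurrent))
      where
      from-I : ∀ {j} → J j × q ∈ runB A w j → ∃[ p ] (p ∈ I × J j × Path w 0 p j q)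
      from-I {j} (Jj , q∈) = let (p , p∈I , P) = runB⇒Path w j q∈ in p , p∈I , Jj , P

    good-successor : ∀ {t s} → Good t s → ∃[ s′ ] (s′ ∈ δ s (w t) × Good (suc t) s′)
    good-successor {t} {s} good =
      map₂ Infinitely-const
        (Infinitely-pigeonhole em _ (Infinitely-map uncons (Infinitely-from (suc t) good)))
      where
      uncons : ∀ {j} → t < j × J j × Path w t s j q →
               ∃[ s′ ] (s′ ∈ δ s (w t) × J j × Path w (suc t) s′ j q)
      uncons (t<j , Jj , P) = let (s′ , s′∈ , P′) = Path-uncons t<j P in s′ , s′∈ , Jj , P′

    good-run : ∀ t → Σ (Fin n) (Good t)
    good-run zero = proj₁ good-initial , proj₂ (proj₂ good-initial)
    good-run (suc t) = let (s′ , _ , good) = good-successor (proj₂ (good-run t)) in s′ , good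

    ρ : ℕ → Fin n
    ρ t = proj₁ (good-run t)

    ρ-good : ∀ t → Good t (ρ t)
    ρ-good t = proj₂ (good-run t)

    ρ-initial : ρ 0 ∈ I
    ρ-initial = proj₁ (proj₂ good-initial)

    ρ-steps : Steps w ρ
    ρ-steps t = proj₁ (proj₂ (good-successor (ρ-good t)))

module Recurrent (em : ExcludedMiddle 0ℓ) {n k} (A : BA n k) (conv : Convention A)
                 (hyp : AllAccSCCsIADAC A) (w : Word k) (q : Fin n)
                 (recurrent : Infinitely (λ j → Nonempty (BA.δF A q (w j)) × q ∈ runB A w j)) where
  open BA A
  open König A em w q (λ j → Nonempty (δF q (w j))) recurrent

  C : Subset n
  C = sccOf A em q

  iad : InitialAlmostDet A C
  iad = let (_ , _ , (_ , r∈δF) , _) = recurrent 0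
        in proj₂ (hyp C (sccOf-AcceptingSCC A em conv r∈δF))

  q-useful : UsefulC A C q
  q-useful = let (_ , _ , (_ , r∈δF) , _) = recurrent 0 in sccOf-UsefulC A em conv r∈δF

  useful : ∀ {s} → Reach A s q → UsefulC A C s
  useful s⇝q = UsefulC-Reach A s⇝q q-useful

  ρ-useful : ∀ t → UsefulC A C (ρ t)
  ρ-useful t = let (_ , _ , _ , P) = ρ-good t 0 in useful (Path⇒Reach A P)

  t₀ : ℕ
  t₀ = proj₁ (Steps⇒eventually-SameSCC A em ρ-steps)

  ρ-SameSCC : ∀ t → t₀ ≤ t → SameSCC A (ρ t) (ρ (suc t))
  ρ-SameSCC = proj₂ (Steps⇒eventually-SameSCC A em ρ-steps)

  -- From t₀ on, every way to q agrees with ρ: each of its steps is useful and ρ stays in its SCC.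
  Path-follows-ρ : ∀ {t s j} → t₀ ≤ t → s ≡ ρ t → Path A w t s j q → ρ j ≡ q
  Path-follows-ρ _ s≡ρt done = sym s≡ρt
  Path-follows-ρ {t} t₀≤t refl (step s′∈ P) =
    Path-follows-ρ (m≤n⇒m≤1+n t₀≤t)
      (IAD-successor-unique A iad (ρ-useful t) (useful (Path⇒Reach A P)) (ρ-useful (suc t))
         s′∈ (ρ-steps t) (ρ-SameSCC t t₀≤t))
      P

  ρ-accepting : InfOften A (AccTr A) w ρ
  ρ-accepting = Infinitely-map take-accepting (Infinitely-map visit-q (ρ-good t₀))
    where
    visit-q : ∀ {j} → Nonempty (δF q (w j)) × Path A w t₀ (ρ t₀) j q →
              Nonempty (δF q (w j)) × ρ j ≡ q
    visit-q (Jj , P) = Jj , Path-follows-ρ ≤-refl refl P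

    take-accepting : ∀ {j} → Nonempty (δF q (w j)) × ρ j ≡ q → AccTr A (ρ j) (w j) (ρ (suc j))
    take-accepting {j} ((r , r∈δF) , ρj≡q) =
      subst₂ (λ x y → y ∈ δF x (w j)) (sym ρj≡q) (sym ρ′≡r) r∈δF
      where
      ρ′≡r : ρ (suc j) ≡ r
      ρ′≡r = IAD-successor-unique A iad
               q-useful (ρ-useful (suc j)) (useful (proj₂ (conv q (w j) r r∈δF)))
               (subst (λ x → ρ (suc j) ∈ δ x (w j)) ρj≡q (ρ-steps j)) (δF⊆δ q (w j) r∈δF)
               (conv q (w j) r r∈δF)

  accepted : InL A w
  accepted = ρ 0 , ρ-initial , ρ , (refl , ρ-steps) , ρ-accepting

theorem1 : ExcludedMiddle 0ℓ →
    ∀ {n k} → 0 < k → (A : BA n k) → Convention A → AllAccSCCsIADAC A →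
    ∀ (w : Word k) → InL A w ⇔ (¬ InLB A w)
theorem1 em _ A conv hyp w = mk⇔ (InL⇒¬InLB A w) λ ¬inLB →
  let (q , recurrent) = ¬InLB⇒recurrent-source A em w ¬inLB
  in Recurrent.accepted em A conv hyp w q recurrent
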